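{- Let $G=(V,E)$ be a popular roommates instance, let $U\subseteq V$ and $Z=V\setminus(N(U)\cup U)$. Let $P$ be a popular matching of $G$ that leaves exactly the vertices of $U$ uncovered. If an edge $(p,q)\in P$ can be reached in $G_P$ by an alternating path (with respect to $P$) that starts with an edge blocking $P$ and whose last vertex is $q$ (so the path ends with the matching edge $(p,q)$), then $q\in Z$.
   Context: A popular roommates instance is a simple graph $G=(V,E)$ in which every vertex $v$ has a strict preference order $\succ_v$ over its neighbours $N(v)$ (the graph need not be complete). For a matching $M$, $M(v)$ denotes the partner of $v$ in $M$, with $M(v)=v$ if $v$ is unmatched; every vertex prefers any neighbour to being unmatched. $N(U)$ is the set of vertices adjacent to at least one vertex of $U$. A vertex $v$ prefers matching $M$ to $M'$ if $v$ is matched in $M$ and unmatched in $M'$, or matched in both and $M(v)\succ_v M'(v)$. $M$ is popular if there is no matching $M'$ such that more vertices prefer $M'$ to $M$ than prefer $M$ to $M'$. An edge $(a,b)\notin M$ blocks $M$ if $b\succ_a M(a)$ and $a\succ_b M(b)$. Each edge $(u,v)\notin M$ gets the label $(\mathrm{vote}_u(v,M),\mathrm{vote}_v(u,M))$, where $\mathrm{vote}_u(v,M)=+$ if $v\succ_u M(u)$ and $-$ if $M(u)\succ_u v$. $G_M$ is the graph obtained from $G$ by deleting all edges labelled $(-,-)$. An alternating path with respect to $M$ is a path whose edges alternate between edges not in $M$ and edges in $M$. -}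

module Defs where

open import Data.Nat using (ℕ; _<_; _≤_; _<ᵇ_)
open import Data.Fin using (Fin; _≟_)
open import Data.Fin.Properties using ()
open import Data.Bool using (Bool; true; false; if_then_else_)
open import Data.List using (List; []; _∷_; _++_; length; filterᵇ; allFin)
open import Data.List.Relation.Unary.Unique.Propositional using (Unique)
open import Data.Product using (_×_; Σ; ∃; _,_)
open import Data.Sum using (_⊎_)
open import Data.Unit using (⊤)
open import Data.Empty using (⊥)
open import Relation.Nullary using (¬_; does)
open import Relation.Binary.PropositionalEquality using (_≡_; _≢_)

-- Adj is the (simple, undirected) edge relation; the strict preference
-- order ≻_v of v over its neighbours N(v) is encoded by a rank:
-- a ≻_v b  iff  rank v a < rank v b, with rank v injective on N(v).
record Instance (n : ℕ) : Set₁ where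
  field
    Adj      : Fin n → Fin n → Set
    Adj-sym  : ∀ {u v} → Adj u v → Adj v u
    Adj-irr  : ∀ {v} → ¬ Adj v v
    rank     : Fin n → Fin n → ℕ
    rank-inj : ∀ v a b → Adj v a → Adj v b → rank v a ≡ rank v b → a ≡ b

module _ {n : ℕ} (G : Instance n) where
  open Instance G

  V : Set
  V = Fin n

  Pref : V → V → V → Set
  Pref v a b = rank v a < rank v b

  -- A matching as the partner map M, with M v ≡ v meaning v is unmatched.
  IsMatching : (V → V) → Set
  IsMatching M = (∀ v → M (M v) ≡ v) × (∀ v → M v ≢ v → Adj v (M v))

  Matched : (V → V) → V → Set
  Matched M v = M v ≢ v

  prefersᵇ : V → (V → V) → (V → V) → Bool
  prefersᵇ v M M' =
    if does (M v ≟ v) then false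
    else (if does (M' v ≟ v) then true else (rank v (M v) <ᵇ rank v (M' v)))

  #prefer : (V → V) → (V → V) → ℕ
  #prefer M M' = length (filterᵇ (λ v → prefersᵇ v M M') (allFin n))

  IsPopular : (V → V) → Set
  IsPopular M = IsMatching M ×
    (∀ M' → IsMatching M' → #prefer M' M ≤ #prefer M M')

  -- vote_u(v, M) = +  :  v ≻_u M(u)  (any neighbour beats being unmatched)
  VotePlus : (V → V) → V → V → Set
  VotePlus M u v = (M u ≡ u) ⊎ (M u ≢ u × Pref u v (M u))

  VoteMinus : (V → V) → V → V → Set
  VoteMinus M u v = M u ≢ u × Pref u (M u) v

  Blocks : (V → V) → V → V → Set
  Blocks M a b = Adj a b × M a ≢ b × VotePlus M a b × VotePlus M b a

  EdgeGM : (V → V) → V → V → Set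
  EdgeGM M u v = Adj u v × (M u ≡ v ⊎ (M u ≢ v × ¬ (VoteMinus M u v × VoteMinus M v u)))

  -- Alternating walk in G_M through the listed vertices, starting at u;
  -- the flag says whether the next edge must be in M (true) or not in M (false).
  AltFrom : (V → V) → Bool → V → List V → Set
  AltFrom M b     u []       = ⊤
  AltFrom M true  u (w ∷ ws) = EdgeGM M u w × M u ≡ w × AltFrom M false w ws
  AltFrom M false u (w ∷ ws) = EdgeGM M u w × M u ≢ w × AltFrom M true w ws

  AltPathGM : (V → V) → List V → Set
  AltPathGM M []       = ⊥
  AltPathGM M (v ∷ vs) = Unique (v ∷ vs) × AltFrom M false v vs

  FirstEdgeBlocks : (V → V) → List V → Set
  FirstEdgeBlocks M (a ∷ b ∷ _) = Blocks M a b
  FirstEdgeBlocks M _           = ⊥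

  InZ : (V → Set) → V → Set
  InZ U v = ¬ U v × (∀ u → U u → ¬ Adj u v)

module Submission where

-- Suppose q ∈ N(U) via some w ∈ U (q ∉ U is immediate, as q is matched to p). Flip P along the
-- path: a is matched to its successor, and every later matching pair (x, y) is broken up so that
-- the preceding free vertex takes x, leaving y free; in the end q is free. Compared with P, the
-- blocking first edge gains two votes, each later non-matching edge lies in G_P and so gains at
-- least nothing, and each vertex left unmatched loses one: only q if a was unmatched in P, and
-- q and P(a) otherwise. In the first case the new matching beats P; in the second, matching q
-- with the P-unmatched vertex w gains at least one more vote, and again P is beaten.

open import Defs
open import Data.Bool using (Bool; true; false)
open import Data.Empty using (⊥-elim)
open import Data.Fin using (Fin; zero; suc; _≟_)
open import Data.Fin.Properties using (punchInᵢ≢i)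
open import Data.Integer using (ℤ; +_; 0ℤ; 1ℤ; -1ℤ; _+_; _-_; _≤_; +≤+; -≤+)
import Data.Integer.Properties as ℤ
open import Data.Integer.Tactic.RingSolver using (solve-∀)
open import Data.List using (List; []; _∷_; _++_; length; filterᵇ; tabulate)
open import Data.List.Relation.Unary.All as All using (All; []; _∷_)
open import Data.List.Relation.Unary.AllPairs as AllPairs using (_∷_)
open import Data.List.Relation.Unary.Unique.Propositional using (Unique)
open import Data.Nat using (zero; suc)
import Data.Nat.Properties as ℕ
open import Data.Product using (_×_; _,_; proj₁; proj₂; ∃-syntax)
open import Data.Sum using (_⊎_; inj₁; inj₂)
open import Data.Unit using (⊤)
open import Data.Vec.Functional using (updateAt; removeAt)
open import Data.Vec.Functional.Properties using (updateAt-updates; updateAt-minimal)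
open import Function using (const; id; flip; _∘_)
open import Relation.Binary.Definitions using (tri<; tri≈; tri>)
open import Relation.Binary.PropositionalEquality
open import Relation.Nullary using (¬_; yes; no)
open import Relation.Nullary.Decidable using (dec-true; dec-false)
open import Algebra.Properties.CommutativeMonoid.Sum ℤ.+-0-commutativeMonoid
  using (sum; sum-remove; sum-cong-≗)

χ : Bool → ℤ
χ true  = 1ℤ
χ false = 0ℤ

χ-χ≥-1 : ∀ b b′ → -1ℤ ≤ χ b - χ b′
χ-χ≥-1 true  true  = -≤+
χ-χ≥-1 true  false = -≤+
χ-χ≥-1 false true  = ℤ.≤-refl
χ-χ≥-1 false false = -≤+

count-filterᵇ : ∀ {A : Set} {m} (b : A → Bool) (f : Fin m → A) →
                + length (filterᵇ b (tabulate f)) ≡ sum (λ i → χ (b (f i)))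
count-filterᵇ {m = zero}  b f = refl
count-filterᵇ {m = suc m} b f with b (f zero)
... | true  = cong (_+_ 1ℤ) (count-filterᵇ b (f ∘ suc))
... | false = trans (count-filterᵇ b (f ∘ suc)) (sym (ℤ.+-identityˡ _))

sum-distrib-- : ∀ {m} (f g : Fin m → ℤ) → sum f - sum g ≡ sum (λ i → f i - g i)
sum-distrib-- {zero}  f g = refl
sum-distrib-- {suc m} f g =
  trans (regroup (f zero) (g zero) (sum (f ∘ suc)) (sum (g ∘ suc)))
        (cong (_+_ (f zero - g zero)) (sum-distrib-- (f ∘ suc) (g ∘ suc)))
  where
  regroup : ∀ a b s t → (a + s) - (b + t) ≡ (a - b) + (s - t)
  regroup = solve-∀

sum-update : ∀ {m} (f g : Fin m → ℤ) (c : Fin m) → (∀ i → i ≢ c → f i ≡ g i) →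
             sum f ≡ sum g + (f c - g c)
sum-update {suc m} f g c f≡g = begin
  sum f                                      ≡⟨ sum-remove {i = c} f ⟩
  f c + sum (removeAt f c)
    ≡⟨ cong (_+_ (f c)) (sum-cong-≗ λ j → f≡g _ (punchInᵢ≢i c j)) ⟩
  f c + sum (removeAt g c)                   ≡⟨ regroup (f c) (g c) (sum (removeAt g c)) ⟩
  (g c + sum (removeAt g c)) + (f c - g c)   ≡⟨ cong (_+ (f c - g c)) (sum-remove {i = c} g) ⟨
  sum g + (f c - g c)                        ∎
  where
  open ≡-Reasoning
  regroup : ∀ a b s → a + s ≡ (b + s) + (a - b)
  regroup = solve-∀

infixl 9 _[_≔_]
_[_≔_] : ∀ {n} → (Fin n → Fin n) → Fin n → Fin n → Fin n → Fin n
M [ v ≔ w ] = updateAt M v (const w)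

free : ∀ {n} → (Fin n → Fin n) → Fin n → Fin n → Fin n
free M v = M [ v ≔ v ] [ M v ≔ M v ]

join : ∀ {n} → (Fin n → Fin n) → Fin n → Fin n → Fin n → Fin n
join M c x = M [ c ≔ x ] [ x ≔ c ]

augment : ∀ {n} → (Fin n → Fin n) → Fin n → Fin n → Fin n → Fin n
augment M c x = join (free M x) c x

module _ {n} {M : Fin n → Fin n} where

  free-partner : ∀ {v} → free M v (M v) ≡ M v
  free-partner {v} = updateAt-updates (M v) (M [ v ≔ v ])

  free-self : ∀ {v} → M v ≢ v → free M v v ≡ v
  free-self {v} Mv≢v = trans (updateAt-minimal v (M v) _ (≢-sym Mv≢v)) (updateAt-updates v M)

  free-other : ∀ {u v} → u ≢ v → u ≢ M v → free M v u ≡ M u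
  free-other {u} {v} u≢v u≢Mv = trans (updateAt-minimal u (M v) _ u≢Mv) (updateAt-minimal u v M u≢v)

  join-left : ∀ {c x} → c ≢ x → join M c x c ≡ x
  join-left {c} {x} c≢x = trans (updateAt-minimal c x _ c≢x) (updateAt-updates c M)

  join-right : ∀ {c x} → join M c x x ≡ c
  join-right {c} {x} = updateAt-updates x (M [ c ≔ x ])

  join-other : ∀ {u c x} → u ≢ c → u ≢ x → join M c x u ≡ M u
  join-other {u} {c} {x} u≢c u≢x = trans (updateAt-minimal u x _ u≢x) (updateAt-minimal u c M u≢c)

augment-other : ∀ {n} {M : Fin n → Fin n} {u c x y} → M x ≡ y → u ≢ c → u ≢ x → u ≢ y →
                augment M c x u ≡ M u
augment-other {M = M} Mx≡y u≢c u≢x u≢y =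
  trans (join-other {M = free M _} u≢c u≢x) (free-other u≢x (λ u≡Mx → u≢y (trans u≡Mx Mx≡y)))

adjacent⇒distinct : ∀ {n} (G : Instance n) {u v} → Instance.Adj G u v → u ≢ v
adjacent⇒distinct G uv refl = Instance.Adj-irr G uv

module Matching {n} (G : Instance n) {M : Fin n → Fin n} (M-matching : IsMatching G M) where
  open Instance G

  private
    involutive : ∀ v → M (M v) ≡ v
    involutive = proj₁ M-matching

  partner-sym : ∀ {x y} → M x ≡ y → M y ≡ x
  partner-sym {x} refl = involutive x

  partner-avoids : ∀ {x y z} → M x ≡ y → z ≢ y → M z ≢ x
  partner-avoids Mx≡y z≢y Mz≡x = z≢y (trans (sym (partner-sym Mz≡x)) Mx≡y)

  partner-injective : ∀ {u w} → M u ≡ M w → u ≡ w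
  partner-injective {u} {w} e = trans (sym (involutive u)) (trans (cong M e) (involutive w))

  free-isMatching : ∀ v → IsMatching G (free M v)
  free-isMatching v = involutive′ , adjacent′
    where
    F : Fin n → Fin n
    F = free M v
    outside : ∀ {u} → u ≢ M v → u ≢ v → M u ≢ v × M u ≢ M v
    outside u≢Mv u≢v = (λ Mu≡v → u≢Mv (sym (partner-sym Mu≡v))) , (u≢v ∘ partner-injective)
    involutive′ : ∀ u → F (F u) ≡ u
    involutive′ u with u ≟ M v | u ≟ v
    ... | yes refl | _        = trans (cong F free-partner) free-partner
    ... | no u≢Mv  | yes refl = trans (cong F (free-self (≢-sym u≢Mv))) (free-self (≢-sym u≢Mv))
    ... | no u≢Mv  | no u≢v   =
      let Mu≢v , Mu≢Mv = outside u≢Mv u≢v in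
      trans (cong F (free-other u≢v u≢Mv)) (trans (free-other Mu≢v Mu≢Mv) (involutive u))
    adjacent′ : ∀ u → F u ≢ u → Adj u (F u)
    adjacent′ u Fu≢u with u ≟ M v | u ≟ v
    ... | yes refl | _        = ⊥-elim (Fu≢u free-partner)
    ... | no u≢Mv  | yes refl = ⊥-elim (Fu≢u (free-self (≢-sym u≢Mv)))
    ... | no u≢Mv  | no u≢v   =
      let Fu≡Mu = free-other u≢v u≢Mv in
      subst (Adj u) (sym Fu≡Mu) (proj₂ M-matching u (Fu≢u ∘ trans Fu≡Mu))

  join-isMatching : ∀ {c x} → M c ≡ c → M x ≡ x → Adj c x → IsMatching G (join M c x)
  join-isMatching {c} {x} Mc≡c Mx≡x cx = involutive′ , adjacent′
    where
    J′ : Fin n → Fin n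
    J′ = join M c x
    c≢x : c ≢ x
    c≢x = adjacent⇒distinct G cx
    outside : ∀ {u} → u ≢ c → u ≢ x → M u ≢ c × M u ≢ x
    outside u≢c u≢x = (λ e → u≢c (partner-injective (trans e (sym Mc≡c))))
                    , (λ e → u≢x (partner-injective (trans e (sym Mx≡x))))
    involutive′ : ∀ u → J′ (J′ u) ≡ u
    involutive′ u with u ≟ c | u ≟ x
    ... | yes refl | _        = trans (cong J′ (join-left c≢x)) join-right
    ... | no _     | yes refl = trans (cong J′ join-right) (join-left c≢x)
    ... | no u≢c   | no u≢x   =
      let Mu≢c , Mu≢x = outside u≢c u≢x in
      trans (cong J′ (join-other u≢c u≢x)) (trans (join-other Mu≢c Mu≢x) (involutive u))
    adjacent′ : ∀ u → J′ u ≢ u → Adj u (J′ u)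
    adjacent′ u Ju≢u with u ≟ c | u ≟ x
    ... | yes refl | _        = subst (Adj c) (sym (join-left c≢x)) cx
    ... | no _     | yes refl = subst (Adj x) (sym join-right) (Adj-sym cx)
    ... | no u≢c   | no u≢x   =
      let Ju≡Mu = join-other u≢c u≢x in
      subst (Adj u) (sym Ju≡Mu) (proj₂ M-matching u (Ju≢u ∘ trans Ju≡Mu))

FirstEdge : ∀ {n} → (Fin n → Fin n → Set) → Fin n → List (Fin n) → Set
FirstEdge R c []      = ⊤
FirstEdge R c (x ∷ _) = R c x

module Advantage {n} (G : Instance n) (P : Fin n → Fin n) (P-matching : IsMatching G P) where
  open Instance G
  open Matching G P-matching public using (partner-sym; partner-avoids)

  -- How v compares partner w (being unmatched if w ≡ v) with its partner in P: +1, 0 or -1.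
  vote : Fin n → Fin n → ℤ
  vote v w = χ (prefersᵇ G v (const w) P) - χ (prefersᵇ G v P (const w))

  Δ : (Fin n → Fin n) → ℤ
  Δ M = + #prefer G M P - + #prefer G P M

  MorePopular : (Fin n → Fin n) → Set
  MorePopular M = IsMatching G M × 1ℤ ≤ Δ M

  gain : Fin n → Fin n → ℤ
  gain c x = vote c x + vote x c

  -- When c is unmatched in M this is the sum of the votes of all vertices but c; it is the
  -- potential that grows by gain c x each time the free endpoint c of the walk moves on.
  Δ-except : (Fin n → Fin n) → Fin n → ℤ
  Δ-except M c = Δ M - vote c c

  vote-partner : ∀ {v w} → P v ≡ w → vote v w ≡ 0ℤ
  vote-partner {v} refl = ℤ.+-inverseʳ (χ (prefersᵇ G v P P))

  vote-free : ∀ {v} → P v ≢ v → vote v v ≡ -1ℤ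
  vote-free {v} Pv≢v with v ≟ v | P v ≟ v
  ... | no v≢v | _        = ⊥-elim (v≢v refl)
  ... | yes _  | yes Pv≡v = ⊥-elim (Pv≢v Pv≡v)
  ... | yes _  | no _     = refl

  vote-plus : ∀ {v w} → w ≢ v → VotePlus G P v w → vote v w ≡ 1ℤ
  vote-plus {v} {w} w≢v plus with w ≟ v | P v ≟ v | plus
  ... | yes w≡v | _        | _                = ⊥-elim (w≢v w≡v)
  ... | no _    | yes _    | _                = refl
  ... | no _    | no Pv≢v  | inj₁ Pv≡v        = ⊥-elim (Pv≢v Pv≡v)
  ... | no _    | no _     | inj₂ (_ , w≻P) =
    cong₂ (λ b b′ → χ b - χ b′) (dec-true (_ ℕ.<? _) w≻P) (dec-false (_ ℕ.<? _) (ℕ.<⇒≯ w≻P))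

  vote≥-1 : ∀ v w → -1ℤ ≤ vote v w
  vote≥-1 v w = χ-χ≥-1 (prefersᵇ G v (const w) P) (prefersᵇ G v P (const w))

  plus-or-minus : ∀ {v w} → Adj v w → w ≢ P v → VotePlus G P v w ⊎ VoteMinus G P v w
  plus-or-minus {v} {w} vw w≢Pv with P v ≟ v
  ... | yes Pv≡v = inj₁ (inj₁ Pv≡v)
  ... | no Pv≢v with ℕ.<-cmp (rank v w) (rank v (P v))
  ...   | tri< w≻P _ _ = inj₁ (inj₂ (Pv≢v , w≻P))
  ...   | tri≈ _ same _ = ⊥-elim (w≢Pv (rank-inj v w (P v) vw (proj₂ P-matching v Pv≢v) same))
  ...   | tri> _ _ P≻w = inj₂ (Pv≢v , P≻w)

  blocking-gain : ∀ {c x} → Blocks G P c x → gain c x ≡ + 2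
  blocking-gain (cx , _ , c-plus , x-plus) =
    cong₂ _+_ (vote-plus (≢-sym (adjacent⇒distinct G cx)) c-plus)
              (vote-plus (adjacent⇒distinct G cx) x-plus)

  gain-nonneg : ∀ {c x} → EdgeGM G P c x → P c ≢ x → 0ℤ ≤ gain c x
  gain-nonneg (cx , inj₁ Pc≡x) Pc≢x = ⊥-elim (Pc≢x Pc≡x)
  gain-nonneg {c} {x} (cx , inj₂ (_ , not-both-minus)) Pc≢x
    with plus-or-minus cx (≢-sym Pc≢x) | plus-or-minus (Adj-sym cx) (Pc≢x ∘ partner-sym ∘ sym)
  ... | inj₁ c-plus | _ =
    subst (0ℤ ≤_) (cong (_+ vote x c) (sym (vote-plus (≢-sym (adjacent⇒distinct G cx)) c-plus)))
          (ℤ.+-monoʳ-≤ 1ℤ (vote≥-1 x c))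
  ... | inj₂ _ | inj₁ x-plus =
    subst (0ℤ ≤_) (cong (_+_ (vote c x)) (sym (vote-plus (adjacent⇒distinct G cx) x-plus)))
          (ℤ.+-monoˡ-≤ 1ℤ (vote≥-1 c x))
  ... | inj₂ c-minus | inj₂ x-minus = ⊥-elim (not-both-minus (c-minus , x-minus))

  Δ≡sum-vote : ∀ M → Δ M ≡ sum (λ v → vote v (M v))
  Δ≡sum-vote M = trans (cong₂ _-_ (count-filterᵇ (λ v → prefersᵇ G v M P) id)
                                  (count-filterᵇ (λ v → prefersᵇ G v P M) id))
                       (sum-distrib-- (λ v → χ (prefersᵇ G v M P)) (λ v → χ (prefersᵇ G v P M)))

  Δ-self : Δ P ≡ 0ℤ
  Δ-self = ℤ.+-inverseʳ (+ #prefer G P P)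

  Δ-update : ∀ M v w → Δ (M [ v ≔ w ]) ≡ Δ M + (vote v w - vote v (M v))
  Δ-update M v w = begin
    Δ (M [ v ≔ w ])                                          ≡⟨ Δ≡sum-vote _ ⟩
    sum (λ u → vote u ((M [ v ≔ w ]) u))                     ≡⟨ sum-update _ _ v untouched ⟩
    sum (λ u → vote u (M u)) + (vote v ((M [ v ≔ w ]) v) - vote v (M v))
      ≡⟨ cong₂ (λ s w′ → s + (vote v w′ - vote v (M v))) (sym (Δ≡sum-vote M)) (updateAt-updates v M) ⟩
    Δ M + (vote v w - vote v (M v))                          ∎
    where
    open ≡-Reasoning
    untouched : ∀ u → u ≢ v → vote u ((M [ v ≔ w ]) u) ≡ vote u (M u)
    untouched u u≢v = cong (vote u) (updateAt-minimal u v M u≢v)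

  Δ-free : ∀ {M v} → IsMatching G M → M v ≡ P v → P v ≢ v → Δ (free M v) ≡ Δ M - + 2
  Δ-free {M} {v} M-matching Mv≡Pv Pv≢v = begin
    Δ (free M v)                                             ≡⟨ Δ-update (M [ v ≔ v ]) w w ⟩
    Δ (M [ v ≔ v ]) + (vote w w - vote w ((M [ v ≔ v ]) w))
      ≡⟨ cong₂ (λ d u → d + (vote w w - vote w u)) (Δ-update M v v) w↦v ⟩
    Δ M + (vote v v - vote v w) + (vote w w - vote w v)
      ≡⟨ cong₂ (λ s t → Δ M + s + t) (cong₂ _-_ (vote-free Pv≢v) (vote-partner (sym Mv≡Pv)))
                                      (cong₂ _-_ (vote-free Pw≢w) (vote-partner Pw≡v)) ⟩
    Δ M + -1ℤ + -1ℤ                                          ≡⟨ regroup (Δ M) ⟩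
    Δ M - + 2                                                ∎
    where
    open ≡-Reasoning
    w : Fin n
    w = M v
    Pw≡v : P w ≡ v
    Pw≡v = partner-sym (sym Mv≡Pv)
    Pw≢w : P w ≢ w
    Pw≢w Pw≡w = Pv≢v (trans (sym Mv≡Pv) (trans (sym Pw≡w) Pw≡v))
    w↦v : (M [ v ≔ v ]) w ≡ v
    w↦v = trans (updateAt-minimal w v M (Pv≢v ∘ trans (sym Mv≡Pv))) (proj₁ M-matching v)
    regroup : ∀ d → d + -1ℤ + -1ℤ ≡ d - + 2
    regroup = solve-∀

  Δ-join : ∀ {M c x} → M c ≡ c → M x ≡ x → c ≢ x →
           Δ (join M c x) ≡ Δ M + (vote c x - vote c c) + (vote x c - vote x x)
  Δ-join {M} {c} {x} Mc≡c Mx≡x c≢x = begin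
    Δ (join M c x)                                           ≡⟨ Δ-update (M [ c ≔ x ]) x c ⟩
    Δ (M [ c ≔ x ]) + (vote x c - vote x ((M [ c ≔ x ]) x))
      ≡⟨ cong₂ (λ d u → d + (vote x c - vote x u)) (Δ-update M c x)
               (trans (updateAt-minimal x c M (≢-sym c≢x)) Mx≡x) ⟩
    Δ M + (vote c x - vote c (M c)) + (vote x c - vote x x)
      ≡⟨ cong (λ u → Δ M + (vote c x - vote c u) + (vote x c - vote x x)) Mc≡c ⟩
    Δ M + (vote c x - vote c c) + (vote x c - vote x x)      ∎
    where open ≡-Reasoning

  Δ-except-matched : ∀ {M c} → P c ≢ c → Δ-except M c + -1ℤ ≡ Δ M
  Δ-except-matched {M} {c} Pc≢c = trans (cong (λ t → Δ M - t + -1ℤ) (vote-free Pc≢c)) (cancel (Δ M))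
    where
    cancel : ∀ d → d - -1ℤ + -1ℤ ≡ d
    cancel = solve-∀

  alternating⇒first-gain≥0 : ∀ {c} rs → AltFrom G P false c rs →
                             FirstEdge (λ c x → 0ℤ ≤ gain c x) c rs
  alternating⇒first-gain≥0 []      _                 = _
  alternating⇒first-gain≥0 (x ∷ _) (cx , Pc≢x , _) = gain-nonneg cx Pc≢x

  blocking⇒first-gain≥2 : ∀ {c} rs → FirstEdgeBlocks G P (c ∷ rs) →
                          FirstEdge (λ c x → + 2 ≤ gain c x) c rs
  blocking⇒first-gain≥2 (x ∷ _) cx-blocks = ℤ.≤-reflexive (sym (blocking-gain cx-blocks))

module AugmentingWalk {n} (G : Instance n) (P : Fin n → Fin n) (P-matching : IsMatching G P)
                      (a p q : Fin n) (Pp≡q : P p ≡ q) where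
  open Instance G
  open Advantage G P P-matching

  Pq≡p : P q ≡ p
  Pq≡p = partner-sym Pp≡q

  record Invariant (M : Fin n → Fin n) (c : Fin n) (rs : List (Fin n)) : Set where
    field
      matching     : IsMatching G M
      end-free     : M c ≡ c
      agrees-ahead : All (λ v → M v ≡ P v) rs
      keeps-free   : ∀ v → P v ≡ v → v ≢ a → M v ≡ v

  step : ∀ {M c x y rs} → Invariant M c (x ∷ y ∷ rs) → Unique (c ∷ x ∷ y ∷ rs) →
         Adj c x → P x ≡ y → (P c ≡ c → c ≡ a) →
         Invariant (augment M c x) y rs × Δ-except (augment M c x) y ≡ Δ-except M c + gain c x
  step {M} {c} {x} {y} {rs}
       record { matching = M-matching ; end-free = Mc≡c
              ; agrees-ahead = Mx≡Px ∷ _ ∷ ahead ; keeps-free = M-keeps }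
       ((c≢x ∷ c≢y ∷ c∉rs) ∷ (x≢y ∷ x∉rs) ∷ (y∉rs ∷ _)) cx Px≡y c-free⇒a = invariant , Δ-step
    where
    open ≡-Reasoning
    Mx≡y : M x ≡ y
    Mx≡y = trans Mx≡Px Px≡y
    Py≡x : P y ≡ x
    Py≡x = partner-sym Px≡y
    Px≢x : P x ≢ x
    Px≢x Px≡x = x≢y (trans (sym Px≡x) Px≡y)
    Py≢y : P y ≢ y
    Py≢y Py≡y = x≢y (trans (sym Py≡x) Py≡y)
    Fc≡c : free M x c ≡ c
    Fc≡c = trans (free-other c≢x (c≢y ∘ flip trans Mx≡y)) Mc≡c
    Fx≡x : free M x x ≡ x
    Fx≡x = free-self (x≢y ∘ sym ∘ trans (sym Mx≡y))
    invariant : Invariant (augment M c x) y rs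
    invariant = record
      { matching     = Matching.join-isMatching G (Matching.free-isMatching G M-matching x) Fc≡c Fx≡x cx
      ; end-free     = trans (join-other (≢-sym c≢y) (≢-sym x≢y))
                             (subst (λ z → free M x z ≡ z) Mx≡y free-partner)
      ; agrees-ahead = All.tabulate λ v∈rs →
          trans (augment-other Mx≡y (≢-sym (All.lookup c∉rs v∈rs)) (≢-sym (All.lookup x∉rs v∈rs))
                                    (≢-sym (All.lookup y∉rs v∈rs)))
                (All.lookup ahead v∈rs)
      ; keeps-free   = λ v Pv≡v v≢a →
          let v≢c = λ { refl → v≢a (c-free⇒a Pv≡v) }
              v≢x = λ { refl → Px≢x Pv≡v }
              v≢y = λ { refl → Py≢y Pv≡v }
          in trans (augment-other Mx≡y v≢c v≢x v≢y) (M-keeps v Pv≡v v≢a)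
      }
    Δ-step : Δ-except (augment M c x) y ≡ Δ-except M c + gain c x
    Δ-step = begin
      Δ (augment M c x) - vote y y
        ≡⟨ cong (_- vote y y) (Δ-join Fc≡c Fx≡x c≢x) ⟩
      Δ (free M x) + (vote c x - vote c c) + (vote x c - vote x x) - vote y y
        ≡⟨ cong₂ (λ d t → d + (vote c x - vote c c) + (vote x c - t) - vote y y)
                 (Δ-free M-matching Mx≡Px Px≢x) (vote-free Px≢x) ⟩
      Δ M - + 2 + (vote c x - vote c c) + (vote x c - -1ℤ) - vote y y
        ≡⟨ cong (Δ M - + 2 + (vote c x - vote c c) + (vote x c - -1ℤ) -_)
                (vote-free Py≢y) ⟩
      Δ M - + 2 + (vote c x - vote c c) + (vote x c - -1ℤ) - -1ℤ
        ≡⟨ regroup (Δ M) (vote c c) (vote c x) (vote x c) ⟩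
      Δ M - vote c c + (vote c x + vote x c)
        ∎
      where
      regroup : ∀ d t u v → d - + 2 + (u - t) + (v - -1ℤ) - -1ℤ ≡ d - t + (u + v)
      regroup = solve-∀

  walk : ∀ ws {M c b} → Invariant M c (ws ++ p ∷ q ∷ []) →
         AltFrom G P false c (ws ++ p ∷ q ∷ []) →
         Unique (c ∷ ws ++ p ∷ q ∷ []) → (P c ≡ c → c ≡ a) →
         FirstEdge (λ c x → b ≤ gain c x) c (ws ++ p ∷ q ∷ []) →
         ∃[ M′ ] Invariant M′ q [] × Δ-except M c + b ≤ Δ-except M′ q
  walk [] {M} {c} I ((cp , _) , _) unique c-free⇒a b≤gain =
    let I′ , Δ-step = step I unique cp Pp≡q c-free⇒a in
    augment M c p , I′ , subst (Δ-except M c + _ ≤_) (sym Δ-step) (ℤ.+-monoʳ-≤ (Δ-except M c) b≤gain)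
  walk (x ∷ []) _ (_ , _ , _ , _ , _ , Pp≢q , _) _ _ _ = ⊥-elim (Pp≢q Pp≡q)
  walk (x ∷ y ∷ ws) {M} {c} {b} I ((cx , _) , _ , _ , Px≡y , alt)
       unique@(_ ∷ (x≢y ∷ _) ∷ unique′) c-free⇒a b≤gain =
    let I₁ , Δ-step = step I unique cx Px≡y c-free⇒a
        M′ , I′ , Δ-walk = walk ws I₁ alt unique′ y-free⇒a
                                (alternating⇒first-gain≥0 (ws ++ p ∷ q ∷ []) alt)
    in M′ , I′ , (begin
      Δ-except M c + b                   ≤⟨ ℤ.+-monoʳ-≤ (Δ-except M c) b≤gain ⟩
      Δ-except M c + gain c x            ≡⟨ Δ-step ⟨
      Δ-except (augment M c x) y         ≡⟨ ℤ.+-identityʳ _ ⟨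
      Δ-except (augment M c x) y + 0ℤ    ≤⟨ Δ-walk ⟩
      Δ-except M′ q                      ∎)
    where
    open ℤ.≤-Reasoning
    y-free⇒a : P y ≡ y → y ≡ a
    y-free⇒a Py≡y = ⊥-elim (x≢y (trans (sym (partner-sym Px≡y)) Py≡y))

  partner-off-path : ∀ ws {c z} → AltFrom G P false c (ws ++ p ∷ q ∷ []) →
                     All (z ≢_) (ws ++ p ∷ q ∷ []) → All (P z ≢_) (ws ++ p ∷ q ∷ [])
  partner-off-path []           _                        (z≢p ∷ z≢q ∷ []) =
    partner-avoids Pp≡q z≢q ∷ partner-avoids Pq≡p z≢p ∷ []
  partner-off-path (x ∷ [])     (_ , _ , _ , _ , _ , Pp≢q , _) _ = ⊥-elim (Pp≢q Pp≡q)
  partner-off-path (x ∷ y ∷ ws) (_ , _ , _ , Px≡y , alt) (z≢x ∷ z≢y ∷ z∉ws) =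
    partner-avoids Px≡y z≢y ∷ partner-avoids (partner-sym Px≡y) z≢x ∷
    partner-off-path ws alt z∉ws

  last-pair-distinct : ∀ ws → Unique (ws ++ p ∷ q ∷ []) → p ≢ q
  last-pair-distinct []       ((p≢q ∷ []) ∷ _) = p≢q
  last-pair-distinct (_ ∷ ws) (_ ∷ unique)     = last-pair-distinct ws unique

  start-unmatched : ∀ {rs} → P a ≡ a → Invariant P a rs × Δ-except P a ≡ 0ℤ
  start-unmatched Pa≡a =
    record { matching = P-matching ; end-free = Pa≡a
           ; agrees-ahead = All.tabulate (λ _ → refl) ; keeps-free = λ _ Pv≡v _ → Pv≡v }
    , cong₂ _-_ Δ-self (vote-partner Pa≡a)

  start-matched : ∀ ws → P a ≢ a → AltFrom G P false a (ws ++ p ∷ q ∷ []) →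
                  All (a ≢_) (ws ++ p ∷ q ∷ []) →
                  Invariant (free P a) a (ws ++ p ∷ q ∷ []) × Δ-except (free P a) a ≡ -1ℤ
  start-matched ws Pa≢a alt a∉path =
    record { matching = Matching.free-isMatching G P-matching a ; end-free = free-self Pa≢a
           ; agrees-ahead = All.tabulate λ v∈path →
               free-other (≢-sym (All.lookup a∉path v∈path)) (≢-sym (All.lookup Pa∉path v∈path))
           ; keeps-free = λ v Pv≡v v≢a →
               trans (free-other v≢a (partner-avoids Pv≡v (≢-sym v≢a) ∘ sym)) Pv≡v }
    , cong₂ _-_ (trans (Δ-free P-matching refl Pa≢a) (cong (_- + 2) Δ-self)) (vote-free Pa≢a)
    where
    Pa∉path : All (P a ≢_) (ws ++ p ∷ q ∷ [])
    Pa∉path = partner-off-path ws alt a∉path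

  join-end-with-unmatched : ∀ {M w} → Invariant M q [] → P q ≢ q → P w ≡ w → w ≢ a → Adj q w →
                            IsMatching G (join M q w) × Δ-except M q ≤ Δ (join M q w)
  join-end-with-unmatched {M} {w} I Pq≢q Pw≡w w≢a qw =
    Matching.join-isMatching G matching end-free Mw≡w qw , (begin
      Δ-except M q                                         ≡⟨ ℤ.+-identityʳ _ ⟨
      Δ-except M q + (-1ℤ + 1ℤ)
        ≤⟨ ℤ.+-monoʳ-≤ (Δ-except M q) (ℤ.+-monoˡ-≤ 1ℤ (vote≥-1 q w)) ⟩
      Δ-except M q + (vote q w + 1ℤ)                       ≡⟨ regroup (Δ M) (vote q q) (vote q w) ⟩
      Δ M + (vote q w - vote q q) + (1ℤ - 0ℤ)
        ≡⟨ cong₂ (λ s t → Δ M + (vote q w - vote q q) + (s - t))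
                 (vote-plus q≢w (inj₁ Pw≡w)) (vote-partner Pw≡w) ⟨
      Δ M + (vote q w - vote q q) + (vote w q - vote w w)  ≡⟨ Δ-join end-free Mw≡w q≢w ⟨
      Δ (join M q w)                                       ∎)
    where
    open Invariant I
    open ℤ.≤-Reasoning
    Mw≡w : M w ≡ w
    Mw≡w = keeps-free w Pw≡w w≢a
    q≢w : q ≢ w
    q≢w refl = Pq≢q Pw≡w
    regroup : ∀ d t u → d - t + (u + 1ℤ) ≡ d + (u - t) + (1ℤ - 0ℤ)
    regroup = solve-∀

  module _ (ws : List (Fin n)) (path : AltPathGM G P (a ∷ ws ++ p ∷ q ∷ []))
           (blocks : FirstEdgeBlocks G P (a ∷ ws ++ p ∷ q ∷ [])) where

    end-matched : P q ≢ q
    end-matched Pq≡q = last-pair-distinct ws (AllPairs.tail (proj₁ path)) (trans (sym Pq≡p) Pq≡q)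

    escape : ∀ {M₀} → Invariant M₀ a (ws ++ p ∷ q ∷ []) →
             ∃[ M ] Invariant M q [] × Δ-except M₀ a + + 2 ≤ Δ-except M q
    escape I₀ = walk ws I₀ (proj₂ path) (proj₁ path) (λ _ → refl)
                     (blocking⇒first-gain≥2 (ws ++ p ∷ q ∷ []) blocks)

    improvement-from-unmatched-start : P a ≡ a → ∃[ M ] MorePopular M
    improvement-from-unmatched-start Pa≡a =
      let I₀ , Δ₀ = start-unmatched Pa≡a
          M , I , Δ-walk = escape I₀
      in M , Invariant.matching I , (begin
        1ℤ                          ≡⟨ cong (λ d → d + + 2 + -1ℤ) Δ₀ ⟨
        Δ-except P a + + 2 + -1ℤ    ≤⟨ ℤ.+-monoˡ-≤ -1ℤ Δ-walk ⟩
        Δ-except M q + -1ℤ          ≡⟨ Δ-except-matched end-matched ⟩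
        Δ M                         ∎)
      where open ℤ.≤-Reasoning

    improvement-from-matched-start : P a ≢ a → ∀ {w} → P w ≡ w → Adj q w →
                                     ∃[ M ] MorePopular M
    improvement-from-matched-start Pa≢a {w} Pw≡w qw =
      let I₀ , Δ₀ = start-matched ws Pa≢a (proj₂ path) (AllPairs.head (proj₁ path))
          M , I , Δ-walk = escape I₀
          M′-matching , Δ-join-end =
            join-end-with-unmatched I end-matched Pw≡w (λ { refl → Pa≢a Pw≡w }) qw
      in join M q w , M′-matching , (begin
        1ℤ                          ≡⟨ cong (_+ + 2) Δ₀ ⟨
        Δ-except (free P a) a + + 2 ≤⟨ Δ-walk ⟩
        Δ-except M q                ≤⟨ Δ-join-end ⟩
        Δ (join M q w)              ∎)
      where open ℤ.≤-Reasoning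

claim2 : ∀ {n} (G : Instance n) (U : V G → Set) (P : V G → V G) →
         IsPopular G P →
         (∀ v → (P v ≡ v → U v) × (U v → P v ≡ v)) →
         ∀ (p q : V G) → P p ≡ q →
         ∀ (a : V G) (ws : List (V G)) →
         AltPathGM G P (a ∷ ws ++ p ∷ q ∷ []) →
         FirstEdgeBlocks G P (a ∷ ws ++ p ∷ q ∷ []) →
         InZ G U q
claim2 G U P (P-matching , P-popular) U≡unmatched p q Pp≡q a ws path blocks = q∉U , q∉N[U]
  where
  open Instance G
  open Advantage G P P-matching
  open AugmentingWalk G P P-matching a p q Pp≡q

  no-improvement : ¬ (∃[ M ] MorePopular M)
  no-improvement (M , M-matching , 1≤Δ)
    with ℤ.≤-trans 1≤Δ (ℤ.i≤j⇒i-j≤0 (+≤+ (P-popular M M-matching)))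
  ... | +≤+ ()

  q∉U : ¬ U q
  q∉U = end-matched ws path blocks ∘ proj₂ (U≡unmatched q)

  q∉N[U] : ∀ w → U w → ¬ Adj w q
  q∉N[U] w Uw wq with P a ≟ a
  ... | yes Pa≡a = no-improvement (improvement-from-unmatched-start ws path blocks Pa≡a)
  ... | no Pa≢a  = no-improvement
    (improvement-from-matched-start ws path blocks Pa≢a (proj₂ (U≡unmatched w) Uw) (Adj-sym wq))
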